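{- Let $T:\{0,1\}^*\to\{0,1\}^*$ be a morphism such that $T(1)$ is not a prefix of $T(01)$, and suppose $T(01)>T(1)$ in the lexicographic order. Then $T$ is order-reversing on infinite words: for all infinite binary words $u,v$ with $u<v$ we have $T(u)>T(v)$.
   Context: The lexicographic order on binary words (with $0<1$): $u\le v$ if $u$ is a prefix of $v$, or $u=xay$, $v=xbz$ for words $x,y,z$ and letters $a<b$; $u<v$ means $u\le v$ and $u\ne v$. For infinite words the same order is used (the second clause). -}

module Defs where

open import Data.Bool using (Bool; true; false)
open import Data.List using (List; []; _∷_; _++_; concatMap; length)
open import Data.Nat using (ℕ; zero; suc; _<_)
open import Data.Product using (Σ; _×_; ∃; _,_)
open import Data.Sum using (_⊎_)
open import Relation.Binary.PropositionalEquality using (_≡_; _≢_)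

-- Finite binary words: List Bool, with false = 0 and true = 1.
Word : Set
Word = List Bool

InfWord : Set
InfWord = ℕ → Bool

Prefix : Word → Word → Set
Prefix u v = Σ Word λ z → u ++ z ≡ v

LexLe : Word → Word → Set
LexLe u v = Prefix u v ⊎
  Σ Word λ x → Σ Word λ y → Σ Word λ z →
    (u ≡ x ++ (false ∷ y)) × (v ≡ x ++ (true ∷ z))

LexLt : Word → Word → Set
LexLt u v = LexLe u v × u ≢ v

InfLt : InfWord → InfWord → Set
InfLt u v = Σ ℕ λ n → (∀ i → i < n → u i ≡ v i) × (u n ≡ false) × (v n ≡ true)

-- A morphism of {0,1}* is determined by the images of the letters.
Morphism : Set
Morphism = Bool → Word

apply : Morphism → Word → Word
apply T w = concatMap T w

take : ℕ → InfWord → Word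
take zero    u = []
take (suc n) u = u 0 ∷ take n (λ i → u (suc i))

PrefixInf : Word → InfWord → Set
PrefixInf x w = take (length x) w ≡ x

-- w is the image T(u) of the infinite word u: every T(u[0..k)) is a prefix of w.
-- (When both letter images are nonempty, as forced by the hypotheses below,
-- there is exactly one such w.)
IsImage : Morphism → InfWord → InfWord → Set
IsImage T u w = ∀ k → PrefixInf (apply T (take k u)) w

-- Write T(1) = x0y and T(01) = x1z; T(0) is nonempty because T(1) ≠ T(01).
-- If u = p0… and v = p1…, then T(v) begins with T(p)x0 and T(u) with T(p)T(0)T(s),
-- s the continuation of u.  Every prefix q of x1 with |q| ≤ |s| is a prefix of
-- T(0)T(s), by induction on s: if s begins with 1, q is a prefix of T(01); if s
-- begins with 0 and q is longer than T(0), then q = T(0)q′ where q′ is a prefix of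
-- T(1) shorter than x1, hence a prefix of x, and the induction hypothesis applies.
-- So T(u) and T(v) first differ at position |T(p)x|, where T(v) has 0 and T(u) has 1.
module Submission where

open import Defs
open import Data.Bool using (Bool; true; false)
open import Data.List using ([]; _∷_; _++_; _∷ʳ_; length)
open import Data.List.Properties
  using (++-assoc; ++-identityʳ; ++-cancelˡ; length-++; length-++-≤ˡ; concatMap-++;
         ∷-injective; ∷-injectiveˡ; ∷-injectiveʳ)
open import Data.Nat using (zero; suc; _+_; _≤_; _<_; s≤s; z≤n; _≤?_)
open import Data.Nat.Properties using (m+n≤o⇒n≤o; +-comm; ≤-trans; ≤-reflexive; ≰⇒>; <⇒≤)
open import Data.Product using (_,_; map₂)
open import Data.Sum using (inj₁; inj₂)
open import Data.Empty using (⊥-elim)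
open import Relation.Nullary using (¬_; yes; no)
open import Relation.Binary.PropositionalEquality

Prefix-++ʳ : ∀ (p w : Word) → Prefix p (p ++ w)
Prefix-++ʳ p w = w , refl

Prefix-refl : ∀ (p : Word) → Prefix p p
Prefix-refl p = [] , ++-identityʳ p

Prefix-trans : ∀ {p q w : Word} → Prefix p q → Prefix q w → Prefix p w
Prefix-trans {p} (r , refl) (s , refl) = r ++ s , sym (++-assoc p r s)

Prefix-extendʳ : ∀ {p q : Word} w → Prefix p q → Prefix p (q ++ w)
Prefix-extendʳ {q = q} w p≼q = Prefix-trans p≼q (Prefix-++ʳ q w)

Prefix-extendˡ : ∀ {p q : Word} w → Prefix p q → Prefix (w ++ p) (w ++ q)
Prefix-extendˡ {p} w (r , refl) = r , ++-assoc w p r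

Prefix-length-≤ : ∀ {p w : Word} → Prefix p w → length p ≤ length w
Prefix-length-≤ {p} (_ , refl) = length-++-≤ˡ p

Prefix-shorter : ∀ {p q w : Word} → Prefix p w → Prefix q w → length p ≤ length q → Prefix p q
Prefix-shorter {[]}    {q}     _          _        _         = q , refl
Prefix-shorter {c ∷ p} {d ∷ q} (r , refl) (s , eq) (s≤s p≤q) with ∷-injective eq
... | refl , eq′ = map₂ (cong (c ∷_)) (Prefix-shorter {p} {q} (r , refl) (s , eq′) p≤q)

Prefix-cancelˡ : ∀ (a : Word) {p w} → Prefix (a ++ p) (a ++ w) → Prefix p w
Prefix-cancelˡ a {p} (r , eq) = r , ++-cancelˡ a _ _ (trans (sym (++-assoc a p r)) eq)

m+n≤suc[k]⇒n≤k : ∀ {m n k} → 0 < m → m + n ≤ suc k → n ≤ k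
m+n≤suc[k]⇒n≤k {suc m} _ (s≤s m+n≤k) = m+n≤o⇒n≤o m m+n≤k

nonempty⇒0<length : ∀ {w : Word} → w ≢ [] → 0 < length w
nonempty⇒0<length {[]}    w≢[] = ⊥-elim (w≢[] refl)
nonempty⇒0<length {_ ∷ _} _    = s≤s z≤n

take-length : ∀ n (w : InfWord) → length (take n w) ≡ n
take-length zero    w = refl
take-length (suc n) w = cong suc (take-length n (λ i → w (suc i)))

take-cong : ∀ n {u v : InfWord} → (∀ i → i < n → u i ≡ v i) → take n u ≡ take n v
take-cong zero    u≈v = refl
take-cong (suc n) u≈v = cong₂ _∷_ (u≈v 0 (s≤s z≤n)) (take-cong n (λ i i<n → u≈v (suc i) (s≤s i<n)))

take-suc-+ : ∀ n k (w : InfWord) → take (suc n + k) w ≡ take n w ++ w n ∷ take k (λ i → w (suc n + i))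
take-suc-+ zero    k w = refl
take-suc-+ (suc n) k w = cong (w 0 ∷_) (take-suc-+ n k (λ i → w (suc i)))

Prefix-PrefixInf : ∀ {q p : Word} (w : InfWord) → Prefix q p → PrefixInf p w → PrefixInf q w
Prefix-PrefixInf {[]}    w _          _  = refl
Prefix-PrefixInf {c ∷ q} w (r , refl) eq =
  cong₂ _∷_ (∷-injectiveˡ eq) (Prefix-PrefixInf (λ i → w (suc i)) (r , refl) (∷-injectiveʳ eq))

InfLt-fromPrefixInf : ∀ (p r s : Word) {w w′ : InfWord} →
  PrefixInf (p ++ false ∷ r) w′ → PrefixInf (p ++ true ∷ s) w → InfLt w′ w
InfLt-fromPrefixInf [] r s e′ e = 0 , (λ _ ()) , ∷-injectiveˡ e′ , ∷-injectiveˡ e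
InfLt-fromPrefixInf (d ∷ p) r s e′ e
  with InfLt-fromPrefixInf p r s (∷-injectiveʳ e′) (∷-injectiveʳ e)
... | m , agree , w′m , wm = suc m , agree′ , w′m , wm
  where
  agree′ : ∀ i → i < suc m → _ ≡ _
  agree′ zero    _         = trans (∷-injectiveˡ e′) (sym (∷-injectiveˡ e))
  agree′ (suc i) (s≤s i<m) = agree i i<m

IsImage-Prefix : ∀ {T u w} {q : Word} k → IsImage T u w → Prefix q (apply T (take k u)) → PrefixInf q w
IsImage-Prefix {w = w} k Tu≡w q≼ = Prefix-PrefixInf w q≼ (Tu≡w k)

apply-take-suc-+ : ∀ (T : Morphism) n k (w : InfWord) →
  apply T (take (suc n + k) w) ≡ apply T (take n w) ++ T (w n) ++ apply T (take k (λ i → w (suc n + i)))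
apply-take-suc-+ T n k w = trans (cong (apply T) (take-suc-+ n k w)) (concatMap-++ T (take n w) _)

module _ (T : Morphism) {x : Word} {c : Bool}
  (0<|T0| : 0 < length (T false)) (x≼T1 : Prefix x (T true))
  (xc≼T01 : Prefix (x ∷ʳ c) (T false ++ T true)) where

  private
    a = T false
    b = T true

  prefixes-T0-apply : ∀ t {q} → Prefix q (x ∷ʳ c) → length q ≤ length t → Prefix q (a ++ apply T t)
  prefixes-T0-apply []         {[]}    _ _  = _ , refl
  prefixes-T0-apply []         {_ ∷ _} _ ()
  prefixes-T0-apply (true ∷ t) {q} q≼xc _ =
    subst (Prefix q) (++-assoc a b (apply T t)) (Prefix-extendʳ (apply T t) (Prefix-trans q≼xc xc≼T01))
  prefixes-T0-apply (false ∷ t) {q} q≼xc |q|≤|t| with length q ≤? length a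
  ... | yes |q|≤|a| =
    Prefix-extendʳ (apply T (false ∷ t)) (Prefix-shorter (Prefix-trans q≼xc xc≼T01) (Prefix-++ʳ a b) |q|≤|a|)
  ... | no |q|≰|a| with Prefix-shorter (Prefix-++ʳ a b) (Prefix-trans q≼xc xc≼T01) (<⇒≤ (≰⇒> |q|≰|a|))
  ...   | q′ , refl = Prefix-extendˡ a (prefixes-T0-apply t q′≼xc |q′|≤|t|)
    where
    |a|+|q′|≤suc : ∀ {n} → length (a ++ q′) ≤ suc n → length q′ ≤ n
    |a|+|q′|≤suc le = m+n≤suc[k]⇒n≤k 0<|T0| (subst (_≤ _) (length-++ a) le)

    |q′|≤|x| : length q′ ≤ length x
    |q′|≤|x| = |a|+|q′|≤suc (≤-trans (Prefix-length-≤ q≼xc)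
                 (≤-reflexive (trans (length-++ x) (+-comm (length x) 1))))

    q′≼xc : Prefix q′ (x ∷ʳ c)
    q′≼xc = Prefix-extendʳ (c ∷ [])
      (Prefix-shorter (Prefix-cancelˡ a (Prefix-trans q≼xc xc≼T01)) x≼T1 |q′|≤|x|)

    |q′|≤|t| : length q′ ≤ length t
    |q′|≤|t| = |a|+|q′|≤suc |q|≤|t|

lemma18 : (T : Morphism) →
    ¬ Prefix (T true) (apply T (false ∷ true ∷ [])) →
    LexLt (T true) (apply T (false ∷ true ∷ [])) →
    (u v w w′ : InfWord) → IsImage T u w → IsImage T v w′ →
    InfLt u v → InfLt w′ w
lemma18 T T1⋠T01 (inj₁ T1≼T01 , _) _ _ _ _ _ _ _ = ⊥-elim (T1⋠T01 T1≼T01)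
lemma18 T _ (inj₂ (x , y , _ , T1≡x0y , T01≡x1z) , T1≢T01) u v w w′ Tu≡w Tv≡w′ (n , u≈v , un≡0 , vn≡1) =
  InfLt-fromPrefixInf (Tp ++ x) y [] (IsImage-Prefix (suc n + 0) Tv≡w′ Tp·x0≼Tv)
                                     (IsImage-Prefix (suc n + K) Tu≡w Tp·x1≼Tu)
  where
  open ≡-Reasoning
  Tp = apply T (take n u)
  K = length (x ∷ʳ true)
  s = take K (λ i → u (suc n + i))

  x1≼T01 : Prefix (x ∷ʳ true) (T false ++ T true)
  x1≼T01 = _ , trans (++-assoc x _ _) (trans (sym T01≡x1z) (cong (T false ++_) (++-identityʳ (T true))))

  0<|T0| : 0 < length (T false)
  0<|T0| = nonempty⇒0<length {T false} λ T0≡[] →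
    T1≢T01 (sym (trans (cong (_++ (T true ++ [])) T0≡[]) (++-identityʳ (T true))))

  x1≼T0·Ts : Prefix (x ∷ʳ true) (T false ++ apply T s)
  x1≼T0·Ts = prefixes-T0-apply T 0<|T0| (_ , sym T1≡x0y) x1≼T01 s
               (Prefix-refl _) (≤-reflexive (sym (take-length K _)))

  Tp·x0≼Tv : Prefix ((Tp ++ x) ++ false ∷ y) (apply T (take (suc n + 0) v))
  Tp·x0≼Tv = [] , sym (begin
    apply T (take (suc n + 0) v)       ≡⟨ apply-take-suc-+ T n 0 v ⟩
    apply T (take n v) ++ T (v n) ++ [] ≡⟨ cong₂ (λ p d → apply T p ++ T d ++ []) (sym (take-cong n u≈v)) vn≡1 ⟩
    Tp ++ T true ++ []                 ≡⟨ cong (λ r → Tp ++ r ++ []) T1≡x0y ⟩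
    Tp ++ (x ++ false ∷ y) ++ []       ≡⟨ sym (++-assoc Tp _ []) ⟩
    (Tp ++ x ++ false ∷ y) ++ []       ≡⟨ cong (_++ []) (sym (++-assoc Tp x _)) ⟩
    ((Tp ++ x) ++ false ∷ y) ++ []     ∎)

  Tp·x1≼Tu : Prefix ((Tp ++ x) ++ true ∷ []) (apply T (take (suc n + K) u))
  Tp·x1≼Tu = subst₂ Prefix (sym (++-assoc Tp x _))
    (sym (trans (apply-take-suc-+ T n K u) (cong (λ d → Tp ++ T d ++ apply T s) un≡0)))
    (Prefix-extendˡ Tp x1≼T0·Ts)
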